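{- Let $n$ be a positive even integer. Then (i) if $n\ge 4$, $\det(L_n)=\det(L_{n-2})+4(n-2)$; (ii) $\det(L_n)=(n-1)^2$.
   Context: A tournament is a directed graph with exactly one arc between each pair of distinct vertices; $u\rightarrow v$ means the arc goes from $u$ to $v$. For a tournament $T$ on vertices $v_1,\dots,v_n$, its skew-adjacency matrix is the zero-diagonal matrix $S_T=[s_{ij}]$ with $s_{ij}=-s_{ji}=1$ if $v_i\rightarrow v_j$, and $\det(T):=\det(S_T)$ (independent of the vertex ordering). For $m\ge 2$, $L_m$ is the tournament on vertices $u_1,\dots,u_m$ with $u_i\rightarrow u_j$ for $1\le i<j\le m-1$, and for $1\le i\le m-1$: $u_m\rightarrow u_i$ if $i$ is odd and $u_i\rightarrow u_m$ if $i$ is even. -}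

module Defs where

open import Data.Nat as ℕ using (ℕ; zero; suc; _∸_; _<ᵇ_; _≡ᵇ_)
open import Data.Integer as ℤ using (ℤ; +_; _+_; _*_; _-_; -_)
open import Data.Fin using (Fin; zero; suc; toℕ; punchIn)
open import Data.Bool using (Bool; true; false; if_then_else_; _∧_; not)

Matrix : ℕ → Set
Matrix n = Fin n → Fin n → ℤ

isEven : ℕ → Bool
isEven zero = true
isEven (suc n) = not (isEven n)

sgn : ℕ → ℤ
sgn k = if isEven k then + 1 else - (+ 1)

sumFin : ∀ n → (Fin n → ℤ) → ℤ
sumFin zero f = + 0
sumFin (suc n) f = f zero + sumFin n (λ j → f (suc j))

det : ∀ n → Matrix n → ℤ
det zero M = + 1
det (suc n) M =
  sumFin (suc n) (λ j → sgn (toℕ j) * M zero j * det n (λ r c → M (suc r) (punchIn j c)))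

b2z : Bool → ℤ
b2z true = + 1
b2z false = + 0

skew : ∀ n → (Fin n → Fin n → Bool) → Matrix n
skew n arc i j = b2z (arc i j) - b2z (arc j i)

-- The tournament L_m on vertices u_1..u_m, encoded with u_{k+1} ↦ index k : Fin m.
-- Last vertex (index m-1): u_m → u_{a+1} iff a+1 odd, i.e. a even;
--                          u_{a+1} → u_m iff a odd.
L-arc : ∀ m → Fin m → Fin m → Bool
L-arc m i j with toℕ i ≡ᵇ (m ∸ 1) | toℕ j ≡ᵇ (m ∸ 1)
... | false | false = toℕ i <ᵇ toℕ j
... | true  | false = isEven (toℕ j)
... | false | true  = not (isEven (toℕ i))
... | true  | true  = false

detL : ℕ → ℤ
detL m = det m (skew m (L-arc m))

-- S(L_n) is the skew matrix of the transitive tournament on n − 1 vertices, bordered by the row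
-- ((−1)^c)_c and, negated, the same column. Deforming the border to ((−1)^c + 2t)_c gives matrices
-- B_N(t) with B_N(0) = S(L_{N+1}). The column operations c₀ ← c₀ − c₁, then clearing the first row
-- with c₀, expanding, clearing the new first row with its first column and expanding once more turn
-- B_{N+2}(t) into B_N(t + 1), with the two pivots both −1. So for odd N, det B_N(t) = (N + 2t)², by
-- induction from det B_1(t) = (1 + 2t)²; hence det L_n = (n − 1)² for even n, and the recurrence is
-- the identity (n − 1)² = (n − 3)² + 4(n − 2).
module Submission where

open import Defs

open import Data.Bool using (true; false; if_then_else_; T)
open import Data.Empty using (⊥-elim)
open import Data.Fin using (Fin; zero; suc; toℕ; punchIn; punchOut; fromℕ<; _≟_)
open import Data.Fin.Permutation.Components using (transpose)
import Data.Fin.Permutation as Perm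
open import Data.Fin.Properties
  using (punchIn-injective; punchInᵢ≢i; punchIn-punchOut; suc-injective; toℕ<n; toℕ-fromℕ<; toℕ-injective)
open import Data.Integer as ℤ using (ℤ; +_; _+_; _*_; -_; -1ℤ)
open import Data.Integer.Properties
  using (+-*-semiring; neg-involutive; -1*i≡-i; *-cancelˡ-≡; +-inverseʳ; +-identityʳ)
open import Data.Integer.Tactic.RingSolver using (solve-∀)
open import Data.Nat as ℕ using (ℕ; zero; suc; _<ᵇ_; _≡ᵇ_; _≤_; _<_; _∸_)
import Data.Nat.Properties as ℕ
open import Data.Product using (Σ-syntax; _×_; _,_; ∃)
open import Data.Sum as Sum using (_⊎_; inj₁; inj₂)
open import Data.Vec.Functional using (updateAt)
open import Data.Vec.Functional.Properties using (updateAt-updates; updateAt-minimal)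
open import Function using (_∘_)
open import Relation.Binary.Construct.Closure.Transitive using (TransClosure; [_]; _∷_)
open import Relation.Binary.PropositionalEquality
open import Relation.Nullary using (Dec; yes; no)
open import Relation.Nullary.Decidable using (dec-true; dec-false)

open import Algebra.Properties.Semiring.Sum +-*-semiring
  using (sum; sum-cong-≗; sum-replicate-zero; ∑-distrib-+; *-distribˡ-sum; ∑-permute)

private
  variable
    n : ℕ

-- Column operations and the determinant

sumFin≡sum : ∀ n (f : Fin n → ℤ) → sumFin n f ≡ sum f
sumFin≡sum zero    f = refl
sumFin≡sum (suc n) f = cong (λ s → f zero + s) (sumFin≡sum n (f ∘ suc))

sum-zero : (f : Fin n → ℤ) → (∀ j → f j ≡ + 0) → sum f ≡ + 0
sum-zero {n} f f≗0 = trans (sum-cong-≗ f≗0) (sum-replicate-zero n)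

minor : Matrix (suc n) → Fin (suc n) → Matrix n
minor M j r c = M (suc r) (punchIn j c)

expansionTerm : Matrix (suc n) → Fin (suc n) → ℤ
expansionTerm {n} M j = sgn (toℕ j) * M zero j * det n (minor M j)

det-expansion : ∀ n (M : Matrix (suc n)) → det (suc n) M ≡ sum (expansionTerm M)
det-expansion n M = sumFin≡sum (suc n) (expansionTerm M)

det-cong : ∀ n {A B : Matrix n} → (∀ r c → A r c ≡ B r c) → det n A ≡ det n B
det-cong zero    A≗B = refl
det-cong (suc n) {A} {B} A≗B =
  trans (det-expansion n A) (trans (sum-cong-≗ same-terms) (sym (det-expansion n B)))
  where
  same-terms : ∀ j → expansionTerm A j ≡ expansionTerm B j
  same-terms j =
    cong₂ (λ x y → sgn (toℕ j) * x * y) (A≗B zero j) (det-cong n λ r c → A≗B (suc r) (punchIn j c))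

det-linear-column : ∀ n {A B C : Matrix n} (c : Fin n) (l : ℤ) →
  (∀ r k → k ≢ c → A r k ≡ C r k) → (∀ r k → k ≢ c → B r k ≡ C r k) →
  (∀ r → C r c ≡ A r c + l * B r c) → det n C ≡ det n A + l * det n B
det-linear-column zero    () l _ _ _
det-linear-column (suc n) {A} {B} {C} c l A≗C B≗C C-col = begin
  det (suc n) C                                                 ≡⟨ det-expansion n C ⟩
  sum (expansionTerm C)                                         ≡⟨ sum-cong-≗ term-linear ⟩
  sum (λ j → expansionTerm A j + l * expansionTerm B j)
    ≡⟨ ∑-distrib-+ (expansionTerm A) (λ j → l * expansionTerm B j) ⟩
  sum (expansionTerm A) + sum (λ j → l * expansionTerm B j)
    ≡⟨ cong (λ s → sum (expansionTerm A) + s) (sym (*-distribˡ-sum l (expansionTerm B))) ⟩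
  sum (expansionTerm A) + l * sum (expansionTerm B)
    ≡⟨ sym (cong₂ (λ x y → x + l * y) (det-expansion n A) (det-expansion n B)) ⟩
  det (suc n) A + l * det (suc n) B                             ∎
  where
  open ≡-Reasoning
  term-linear : ∀ j → expansionTerm C j ≡ expansionTerm A j + l * expansionTerm B j
  term-linear j with j ≟ c
  ... | yes refl = begin
    s * C zero j * det n (minor C j)
      ≡⟨ cong (λ x → s * x * det n (minor C j)) (C-col zero) ⟩
    s * (A zero j + l * B zero j) * det n (minor C j)
      ≡⟨ distrib s (A zero j) (B zero j) l (det n (minor C j)) ⟩
    s * A zero j * det n (minor C j) + l * (s * B zero j * det n (minor C j))
      ≡⟨ sym (cong₂ (λ x y → s * A zero j * x + l * (s * B zero j * y))
                    (same-minor A≗C) (same-minor B≗C)) ⟩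
    s * A zero j * det n (minor A j) + l * (s * B zero j * det n (minor B j)) ∎
    where
    s : ℤ
    s = sgn (toℕ j)
    same-minor : ∀ {M} → (∀ r k → k ≢ c → M r k ≡ C r k) → det n (minor M j) ≡ det n (minor C j)
    same-minor M≗C = det-cong n λ r k → M≗C (suc r) (punchIn j k) (punchInᵢ≢i j k)
    distrib : ∀ s a b l d → s * (a + l * b) * d ≡ s * a * d + l * (s * b * d)
    distrib = solve-∀
  ... | no j≢c = begin
    s * C zero j * det n (minor C j)
      ≡⟨ cong (s * C zero j *_) minor-linear ⟩
    s * C zero j * (det n (minor A j) + l * det n (minor B j))
      ≡⟨ distrib s (C zero j) (det n (minor A j)) (det n (minor B j)) l ⟩
    s * C zero j * det n (minor A j) + l * (s * C zero j * det n (minor B j))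
      ≡⟨ sym (cong₂ (λ x y → s * x * det n (minor A j) + l * (s * y * det n (minor B j)))
                    (A≗C zero j j≢c) (B≗C zero j j≢c)) ⟩
    s * A zero j * det n (minor A j) + l * (s * B zero j * det n (minor B j)) ∎
    where
    s : ℤ
    s = sgn (toℕ j)
    c′ : Fin n
    c′ = punchOut j≢c
    punchIn≢c : ∀ k → k ≢ c′ → punchIn j k ≢ c
    punchIn≢c k k≢c′ eq = k≢c′ (punchIn-injective j k c′ (trans eq (sym (punchIn-punchOut j≢c))))
    minor-linear : det n (minor C j) ≡ det n (minor A j) + l * det n (minor B j)
    minor-linear = det-linear-column n c′ l
      (λ r k k≢c′ → A≗C (suc r) (punchIn j k) (punchIn≢c k k≢c′))
      (λ r k k≢c′ → B≗C (suc r) (punchIn j k) (punchIn≢c k k≢c′))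
      (λ r → subst (λ x → C (suc r) x ≡ A (suc r) x + l * B (suc r) x)
                   (sym (punchIn-punchOut j≢c)) (C-col (suc r)))
    distrib : ∀ s x a b l → s * x * (a + l * b) ≡ s * x * a + l * (s * x * b)
    distrib = solve-∀

transpose-left : ∀ (i j : Fin n) → transpose i j i ≡ j
transpose-left i j rewrite dec-true (i ≟ i) refl = refl

transpose-right : ∀ (i j : Fin n) → transpose i j j ≡ i
transpose-right i j with j ≟ i
... | yes j≡i = j≡i
... | no  j≢i rewrite dec-true (j ≟ j) refl = refl

transpose-other : ∀ {i j k : Fin n} → k ≢ i → k ≢ j → transpose i j k ≡ k
transpose-other {i = i} {j} {k} k≢i k≢j rewrite dec-false (k ≟ i) k≢i | dec-false (k ≟ j) k≢j = refl

transpose-injective-map : ∀ {m} (f : Fin m → Fin n) → (∀ {x y} → f x ≡ f y → x ≡ y) →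
  ∀ i j k → transpose (f i) (f j) (f k) ≡ f (transpose i j k)
transpose-injective-map f f-inj i j k = go (k ≟ i) (k ≟ j)
  where
  go : Dec (k ≡ i) → Dec (k ≡ j) → transpose (f i) (f j) (f k) ≡ f (transpose i j k)
  go (yes refl) _          = trans (transpose-left (f k) (f j)) (cong f (sym (transpose-left k j)))
  go (no  _)    (yes refl) = trans (transpose-right (f i) (f k)) (cong f (sym (transpose-right i k)))
  go (no  k≢i)  (no  k≢j)  =
    trans (transpose-other (k≢i ∘ f-inj) (k≢j ∘ f-inj)) (cong f (sym (transpose-other k≢i k≢j)))

data Adjacent : Fin n → Fin n → Set where
  zero-one : Adjacent {suc (suc n)} zero (suc zero)
  suc-suc  : {a b : Fin n} → Adjacent a b → Adjacent (suc a) (suc b)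

adjacent-toℕ : {a b : Fin n} → Adjacent a b → toℕ b ≡ suc (toℕ a)
adjacent-toℕ zero-one    = refl
adjacent-toℕ (suc-suc p) = cong suc (adjacent-toℕ p)

sgn-suc : ∀ k → sgn (suc k) ≡ - sgn k
sgn-suc k with isEven k
... | true  = refl
... | false = refl

adjacent-sgn : {a b : Fin n} → Adjacent a b → sgn (toℕ b) ≡ - sgn (toℕ a)
adjacent-sgn {a = a} p = trans (cong sgn (adjacent-toℕ p)) (sgn-suc (toℕ a))

transpose-suc : ∀ (i j k : Fin n) → transpose (suc i) (suc j) (suc k) ≡ suc (transpose i j k)
transpose-suc = transpose-injective-map suc suc-injective

transpose-punchInˡ : {a b : Fin (suc n)} → Adjacent a b →
  ∀ k → transpose a b (punchIn a k) ≡ punchIn b k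
transpose-punchInˡ zero-one    zero    = refl
transpose-punchInˡ zero-one    (suc k) = refl
transpose-punchInˡ (suc-suc p) zero    = refl
transpose-punchInˡ {suc n} {suc a} {suc b} (suc-suc p) (suc k) =
  trans (transpose-suc a b (punchIn a k)) (cong suc (transpose-punchInˡ p k))

transpose-punchInʳ : {a b : Fin (suc n)} → Adjacent a b →
  ∀ k → transpose a b (punchIn b k) ≡ punchIn a k
transpose-punchInʳ zero-one    zero    = refl
transpose-punchInʳ zero-one    (suc k) = refl
transpose-punchInʳ (suc-suc p) zero    = refl
transpose-punchInʳ {suc n} {suc a} {suc b} (suc-suc p) (suc k) =
  trans (transpose-suc a b (punchIn b k)) (cong suc (transpose-punchInʳ p k))

adjacent-punchOut : {a b : Fin (suc n)} (j : Fin (suc n)) → Adjacent a b → j ≢ a → j ≢ b →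
  Σ[ a′ ∈ Fin n ] Σ[ b′ ∈ Fin n ] Adjacent a′ b′ × punchIn j a′ ≡ a × punchIn j b′ ≡ b
adjacent-punchOut zero zero-one j≢a _ = ⊥-elim (j≢a refl)
adjacent-punchOut zero (suc-suc p) _ _ = _ , _ , p , refl , refl
adjacent-punchOut (suc zero) zero-one _ j≢b = ⊥-elim (j≢b refl)
adjacent-punchOut {suc (suc n)} (suc (suc j)) zero-one _ _ = zero , suc zero , zero-one , refl , refl
adjacent-punchOut {suc n} (suc j) (suc-suc p) j≢a j≢b
  with adjacent-punchOut j p (j≢a ∘ cong suc) (j≢b ∘ cong suc)
... | a′ , b′ , q , refl , refl = suc a′ , suc b′ , suc-suc q , refl , refl

swapColumns : Fin n → Fin n → Matrix n → Matrix n
swapColumns a b A r k = A r (transpose a b k)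

-- The expansion terms of the swapped matrix are those of A, negated and permuted by the
-- transposition: for j ∈ {a, b} because adjacent columns have opposite signs and the same minor
-- after exchange, for the other j by induction on the minor.
det-swap-adjacent : ∀ n {a b : Fin n} (A : Matrix n) → Adjacent a b →
  det n (swapColumns a b A) ≡ - det n A
det-swap-adjacent (suc n) {a} {b} A p = begin
  det (suc n) B                                        ≡⟨ det-expansion n B ⟩
  sum (expansionTerm B)                                ≡⟨ sum-cong-≗ term-swapped ⟩
  sum (λ j → -1ℤ * expansionTerm A (transpose a b j))
    ≡⟨ sym (*-distribˡ-sum -1ℤ (expansionTerm A ∘ transpose a b)) ⟩
  -1ℤ * sum (λ j → expansionTerm A (transpose a b j))
    ≡⟨ cong (-1ℤ *_) (sym (∑-permute (expansionTerm A) (Perm.transpose a b))) ⟩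
  -1ℤ * sum (expansionTerm A)                          ≡⟨ -1*i≡-i _ ⟩
  - sum (expansionTerm A)                              ≡⟨ cong -_ (sym (det-expansion n A)) ⟩
  - det (suc n) A                                      ∎
  where
  open ≡-Reasoning
  B : Matrix (suc n)
  B = swapColumns a b A

  exchanged-term : ∀ {x y} → transpose a b x ≡ y → (∀ k → transpose a b (punchIn x k) ≡ punchIn y k) →
    sgn (toℕ y) ≡ - sgn (toℕ x) → expansionTerm B x ≡ -1ℤ * expansionTerm A y
  exchanged-term {x} {y} τx≡y τ-punchIn sgn-y = begin
    sgn (toℕ x) * A zero (transpose a b x) * det n (minor B x)
      ≡⟨ cong₂ (λ u v → sgn (toℕ x) * A zero u * v) τx≡y
               (det-cong n λ r k → cong (A (suc r)) (τ-punchIn k)) ⟩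
    sgn (toℕ x) * A zero y * det n (minor A y)
      ≡⟨ sign-flip (sgn (toℕ x)) (A zero y) (det n (minor A y)) ⟩
    -1ℤ * (- sgn (toℕ x) * A zero y * det n (minor A y))
      ≡⟨ cong (λ s → -1ℤ * (s * A zero y * det n (minor A y))) (sym sgn-y) ⟩
    -1ℤ * expansionTerm A y                                     ∎
    where
    sign-flip : ∀ s x d → s * x * d ≡ -1ℤ * (- s * x * d)
    sign-flip = solve-∀

  term-swapped : ∀ j → expansionTerm B j ≡ -1ℤ * expansionTerm A (transpose a b j)
  term-swapped j = cases (j ≟ a) (j ≟ b)
    where
    cases : Dec (j ≡ a) → Dec (j ≡ b) → expansionTerm B j ≡ -1ℤ * expansionTerm A (transpose a b j)
    cases (yes refl) _ =
      trans (exchanged-term {a} {b} (transpose-left a b) (transpose-punchInˡ p) (adjacent-sgn p))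
            (cong (λ y → -1ℤ * expansionTerm A y) (sym (transpose-left a b)))
    cases (no _) (yes refl) =
      trans (exchanged-term {b} {a} (transpose-right a b) (transpose-punchInʳ p) sgn-a)
            (cong (λ y → -1ℤ * expansionTerm A y) (sym (transpose-right a b)))
      where
      sgn-a : sgn (toℕ a) ≡ - sgn (toℕ b)
      sgn-a = trans (sym (neg-involutive _)) (cong -_ (sym (adjacent-sgn p)))
    cases (no j≢a) (no j≢b) with adjacent-punchOut j p j≢a j≢b
    ... | a′ , b′ , q , refl , refl = begin
      expansionTerm B j
        ≡⟨ cong₂ (λ u v → sgn (toℕ j) * A zero u * v) (transpose-other j≢a j≢b) minor-swapped ⟩
      sgn (toℕ j) * A zero j * - det n (minor A j)
        ≡⟨ pull-sign (sgn (toℕ j)) (A zero j) (det n (minor A j)) ⟩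
      -1ℤ * expansionTerm A j
        ≡⟨ cong (λ y → -1ℤ * expansionTerm A y) (sym (transpose-other j≢a j≢b)) ⟩
      -1ℤ * expansionTerm A (transpose a b j) ∎
      where
      minor-swapped : det n (minor B j) ≡ - det n (minor A j)
      minor-swapped = trans
        (det-cong n λ r k →
          cong (A (suc r)) (transpose-injective-map (punchIn j) (punchIn-injective j _ _) a′ b′ k))
        (det-swap-adjacent n (minor A j) q)
      pull-sign : ∀ s x d → s * x * - d ≡ -1ℤ * (s * x * d)
      pull-sign = solve-∀

x≡-x⇒x≡0 : ∀ x → x ≡ - x → x ≡ + 0
x≡-x⇒x≡0 x x≡-x = *-cancelˡ-≡ (+ 2) x (+ 0) (begin
  + 2 * x   ≡⟨ double x ⟩
  x + x     ≡⟨ cong (λ y → x + y) x≡-x ⟩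
  x + - x   ≡⟨ +-inverseʳ x ⟩
  + 0       ∎)
  where
  open ≡-Reasoning
  double : ∀ x → + 2 * x ≡ x + x
  double = solve-∀

swapColumns-equal : ∀ {a b : Fin n} (A : Matrix n) → (∀ r → A r a ≡ A r b) →
  ∀ r k → swapColumns a b A r k ≡ A r k
swapColumns-equal {a = a} {b} A a≗b r k = cases (k ≟ a) (k ≟ b)
  where
  cases : Dec (k ≡ a) → Dec (k ≡ b) → A r (transpose a b k) ≡ A r k
  cases (yes refl) _          = trans (cong (A r) (transpose-left a b)) (sym (a≗b r))
  cases (no _)     (yes refl) = trans (cong (A r) (transpose-right a b)) (a≗b r)
  cases (no k≢a)   (no k≢b)   = cong (A r) (transpose-other k≢a k≢b)

-- toℕ a < toℕ b, presented as a chain of adjacent steps along which equal columns are moved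
-- together by adjacent swaps.
infix 4 _≺_

_≺_ : Fin n → Fin n → Set
_≺_ = TransClosure Adjacent

≺⇒toℕ< : {a b : Fin n} → a ≺ b → toℕ a ℕ.< toℕ b
≺⇒toℕ< [ p ]   = ℕ.≤-reflexive (sym (adjacent-toℕ p))
≺⇒toℕ< (p ∷ q) = ℕ.<-trans (ℕ.≤-reflexive (sym (adjacent-toℕ p))) (≺⇒toℕ< q)

≺⇒≢ : {a b : Fin n} → a ≺ b → b ≢ a
≺⇒≢ a≺b b≡a = ℕ.<⇒≢ (≺⇒toℕ< a≺b) (cong toℕ (sym b≡a))

≺-suc : {a b : Fin n} → a ≺ b → suc a ≺ suc b
≺-suc [ p ]   = [ suc-suc p ]
≺-suc (p ∷ q) = suc-suc p ∷ ≺-suc q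

zero≺suc : ∀ (d : Fin n) → zero ≺ suc d
zero≺suc zero    = [ zero-one ]
zero≺suc (suc d) = zero-one ∷ ≺-suc (zero≺suc d)

≢⇒≺⊎≻ : {a b : Fin n} → a ≢ b → a ≺ b ⊎ b ≺ a
≢⇒≺⊎≻ {a = zero}  {zero}  a≢b = ⊥-elim (a≢b refl)
≢⇒≺⊎≻ {a = zero}  {suc b} _   = inj₁ (zero≺suc b)
≢⇒≺⊎≻ {a = suc a} {zero}  _   = inj₂ (zero≺suc a)
≢⇒≺⊎≻ {a = suc a} {suc b} a≢b = Sum.map ≺-suc ≺-suc (≢⇒≺⊎≻ (a≢b ∘ cong suc))

det-equal-columns-≺ : ∀ n {a b : Fin n} (A : Matrix n) → a ≺ b → (∀ r → A r a ≡ A r b) →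
  det n A ≡ + 0
det-equal-columns-≺ n A [ p ] a≗b =
  x≡-x⇒x≡0 (det n A) (trans (sym (det-cong n (swapColumns-equal A a≗b))) (det-swap-adjacent n A p))
det-equal-columns-≺ n {a} {b} A (_∷_ {y = a′} p a′≺b) a≗b = begin
  det n A         ≡⟨ sym (neg-involutive (det n A)) ⟩
  - - det n A     ≡⟨ cong -_ (sym (det-swap-adjacent n A p)) ⟩
  - det n B       ≡⟨ cong -_ (det-equal-columns-≺ n B a′≺b B-a′≗b) ⟩
  + 0             ∎
  where
  open ≡-Reasoning
  B : Matrix n
  B = swapColumns a a′ A
  B-a′≗b : ∀ r → B r a′ ≡ B r b
  B-a′≗b r = trans (cong (A r) (transpose-right a a′))
               (trans (a≗b r) (cong (A r) (sym (transpose-other (≺⇒≢ (p ∷ a′≺b)) (≺⇒≢ a′≺b)))))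

det-equal-columns : ∀ n {a b : Fin n} (A : Matrix n) → a ≢ b → (∀ r → A r a ≡ A r b) →
  det n A ≡ + 0
det-equal-columns n A a≢b a≗b with ≢⇒≺⊎≻ a≢b
... | inj₁ a≺b = det-equal-columns-≺ n A a≺b a≗b
... | inj₂ b≺a = det-equal-columns-≺ n A b≺a (sym ∘ a≗b)

det-add-column : ∀ n {A C : Matrix n} (c d : Fin n) (l : ℤ) → c ≢ d →
  (∀ r k → k ≢ c → C r k ≡ A r k) → (∀ r → C r c ≡ A r c + l * A r d) → det n C ≡ det n A
det-add-column n {A} {C} c d l c≢d C≗A C-col = begin
  det n C               ≡⟨ det-linear-column n c l (λ r k k≢c → sym (C≗A r k k≢c)) B≗C B-col ⟩
  det n A + l * det n B ≡⟨ cong (λ x → det n A + l * x) (det-equal-columns n B c≢d B-c≗d) ⟩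
  det n A + l * + 0     ≡⟨ drop-zero (det n A) l ⟩
  det n A               ∎
  where
  open ≡-Reasoning
  B : Matrix n
  B r = updateAt (A r) c (λ _ → A r d)
  B≗C : ∀ r k → k ≢ c → B r k ≡ C r k
  B≗C r k k≢c = trans (updateAt-minimal k c (A r) k≢c) (sym (C≗A r k k≢c))
  B-col : ∀ r → C r c ≡ A r c + l * B r c
  B-col r = trans (C-col r) (cong (λ x → A r c + l * x) (sym (updateAt-updates c (A r))))
  B-c≗d : ∀ r → B r c ≡ B r d
  B-c≗d r = trans (updateAt-updates c (A r)) (sym (updateAt-minimal d c (A r) (c≢d ∘ sym)))
  drop-zero : ∀ x l → x + l * + 0 ≡ x
  drop-zero = solve-∀

addMultiplesOfColumn₀ : (Fin n → ℤ) → Matrix (suc n) → Matrix (suc n)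
addMultiplesOfColumn₀ μ A r zero    = A r zero
addMultiplesOfColumn₀ μ A r (suc j) = A r (suc j) + μ j * A r zero

det-addMultiplesOfColumn₀-below : ∀ n k (μ : Fin n → ℤ) (A : Matrix (suc n)) →
  (∀ j → k ≤ toℕ j → μ j ≡ + 0) → det (suc n) (addMultiplesOfColumn₀ μ A) ≡ det (suc n) A
det-addMultiplesOfColumn₀-below n zero μ A μ≗0 = det-cong (suc n) entries
  where
  entries : ∀ r c → addMultiplesOfColumn₀ μ A r c ≡ A r c
  entries r zero    = refl
  entries r (suc j) =
    trans (cong (λ m → A r (suc j) + m * A r zero) (μ≗0 j ℕ.z≤n)) (add-zero (A r (suc j)) (A r zero))
    where
    add-zero : ∀ x y → x + + 0 * y ≡ x
    add-zero = solve-∀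
det-addMultiplesOfColumn₀-below n (suc k) μ A μ≗0 with k ℕ.<? n
... | no  k≮n =
  det-addMultiplesOfColumn₀-below n k μ A λ j k≤j → ⊥-elim (k≮n (ℕ.≤-trans (ℕ.s≤s k≤j) (toℕ<n j)))
... | yes k<n = trans (det-add-column (suc n) (suc c) zero (μ c) (λ ()) same-columns new-column)
                      (det-addMultiplesOfColumn₀-below n k μ′ A μ′≗0)
  where
  c : Fin n
  c = fromℕ< k<n
  μ′ : Fin n → ℤ
  μ′ = updateAt μ c (λ _ → + 0)
  μ′≗0 : ∀ j → k ≤ toℕ j → μ′ j ≡ + 0
  μ′≗0 j k≤j with j ≟ c
  ... | yes refl = updateAt-updates c μ
  ... | no  j≢c  = trans (updateAt-minimal j c μ j≢c) (μ≗0 j (ℕ.≤∧≢⇒< k≤j k≢j))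
    where
    k≢j : k ≢ toℕ j
    k≢j k≡j = j≢c (toℕ-injective (trans (sym k≡j) (sym (toℕ-fromℕ< k<n))))
  same-columns : ∀ r i → i ≢ suc c → addMultiplesOfColumn₀ μ A r i ≡ addMultiplesOfColumn₀ μ′ A r i
  same-columns r zero    _     = refl
  same-columns r (suc j) sj≢sc =
    cong (λ m → A r (suc j) + m * A r zero) (sym (updateAt-minimal j c μ (sj≢sc ∘ cong suc)))
  new-column : ∀ r →
    addMultiplesOfColumn₀ μ A r (suc c) ≡ addMultiplesOfColumn₀ μ′ A r (suc c) + μ c * A r zero
  new-column r = trans (insert-zero (A r (suc c)) (μ c) (A r zero))
                       (cong (λ m → A r (suc c) + m * A r zero + μ c * A r zero) (sym (updateAt-updates c μ)))
    where
    insert-zero : ∀ x m y → x + m * y ≡ x + + 0 * y + m * y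
    insert-zero = solve-∀

det-addMultiplesOfColumn₀ : ∀ n (μ : Fin n → ℤ) (A : Matrix (suc n)) →
  det (suc n) (addMultiplesOfColumn₀ μ A) ≡ det (suc n) A
det-addMultiplesOfColumn₀ n μ A =
  det-addMultiplesOfColumn₀-below n n μ A λ j n≤j → ⊥-elim (ℕ.<⇒≱ (toℕ<n j) n≤j)

det-first-row : ∀ n (A : Matrix (suc n)) → (∀ j → A zero (suc j) ≡ + 0) →
  det (suc n) A ≡ A zero zero * det n (λ r c → A (suc r) (suc c))
det-first-row n A row₀ = begin
  det (suc n) A                                           ≡⟨ det-expansion n A ⟩
  expansionTerm A zero + sum (expansionTerm A ∘ suc)
    ≡⟨ cong (λ s → expansionTerm A zero + s) (sum-zero (expansionTerm A ∘ suc) vanish) ⟩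
  expansionTerm A zero + + 0                              ≡⟨ simplify (A zero zero) (det n (minor A zero)) ⟩
  A zero zero * det n (λ r c → A (suc r) (suc c))         ∎
  where
  open ≡-Reasoning
  vanish : ∀ j → expansionTerm A (suc j) ≡ + 0
  vanish j = trans (cong (λ x → sgn (toℕ (suc j)) * x * det n (minor A (suc j))) (row₀ j))
                   (zero-middle (sgn (toℕ (suc j))) (det n (minor A (suc j))))
    where
    zero-middle : ∀ s d → s * + 0 * d ≡ + 0
    zero-middle = solve-∀
  simplify : ∀ x d → + 1 * x * d + + 0 ≡ x * d
  simplify = solve-∀

-- The tournaments L_n

transitiveEntry : ℕ → ℕ → ℤ
transitiveEntry r c = if r <ᵇ c then + 1 else if c <ᵇ r then -1ℤ else + 0

borderedEntry : ℕ → ℤ → ℕ → ℕ → ℤ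
borderedEntry N t r c =
  if r ≡ᵇ N then (if c ≡ᵇ N then + 0 else sgn c + + 2 * t)
  else (if c ≡ᵇ N then - (sgn r + + 2 * t) else transitiveEntry r c)

bordered : ∀ N → ℤ → Matrix (suc N)
bordered N t i j = borderedEntry N t (toℕ i) (toℕ j)

sgn-suc-suc : ∀ k → sgn (suc (suc k)) ≡ sgn k
sgn-suc-suc k = trans (sgn-suc (suc k)) (trans (cong -_ (sgn-suc k)) (neg-involutive (sgn k)))

det-bordered-step : ∀ N t →
  det (suc (suc (suc N))) (bordered (suc (suc N)) t) ≡ det (suc N) (bordered N (t + + 1))
det-bordered-step N t = begin
  det _ A                        ≡⟨ sym (det-add-column _ zero (suc zero) -1ℤ (λ ()) A₁≗A (λ r → refl)) ⟩
  det _ A₁                       ≡⟨ sym (det-addMultiplesOfColumn₀ _ μ A₁) ⟩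
  det _ A₂                       ≡⟨ det-first-row _ A₂ A₂-row₀ ⟩
  -1ℤ * det _ M₁                 ≡⟨ cong (-1ℤ *_) (sym (det-addMultiplesOfColumn₀ _ ν M₁)) ⟩
  -1ℤ * det _ A₃                 ≡⟨ cong (-1ℤ *_) (det-first-row _ A₃ A₃-row₀) ⟩
  -1ℤ * (-1ℤ * det _ M₂)         ≡⟨ cong (λ d → -1ℤ * (-1ℤ * d)) (det-cong _ M₂≗bordered) ⟩
  -1ℤ * (-1ℤ * det _ B)          ≡⟨ sign-squared (det _ B) ⟩
  det _ B                        ∎
  where
  open ≡-Reasoning
  sign-squared : ∀ d → -1ℤ * (-1ℤ * d) ≡ d
  sign-squared = solve-∀

  A : Matrix (suc (suc (suc N)))
  A = bordered (suc (suc N)) t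

  B : Matrix (suc N)
  B = bordered N (t + + 1)

  A₁ : Matrix (suc (suc (suc N)))
  A₁ r zero    = A r zero + -1ℤ * A r (suc zero)
  A₁ r (suc j) = A r (suc j)

  A₁≗A : ∀ r k → k ≢ zero → A₁ r k ≡ A r k
  A₁≗A r zero    k≢0 = ⊥-elim (k≢0 refl)
  A₁≗A r (suc j) _   = refl

  μ : Fin (suc (suc N)) → ℤ
  μ j = if toℕ j ≡ᵇ suc N then - (+ 1 + + 2 * t) else + 1

  A₂ : Matrix (suc (suc (suc N)))
  A₂ = addMultiplesOfColumn₀ μ A₁

  A₂-row₀ : ∀ j → A₂ zero (suc j) ≡ + 0
  A₂-row₀ j with toℕ j ≡ᵇ suc N
  ... | true  = cancel t
    where
    cancel : ∀ t → - (+ 1 + + 2 * t) + - (+ 1 + + 2 * t) * -1ℤ ≡ + 0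
    cancel = solve-∀
  ... | false = refl

  M₁ : Matrix (suc (suc N))
  M₁ r c = A₂ (suc r) (suc c)

  ν : Fin (suc N) → ℤ
  ν j = if toℕ j ≡ᵇ N then + 2 else + 0

  A₃ : Matrix (suc (suc N))
  A₃ = addMultiplesOfColumn₀ ν M₁

  A₃-row₀ : ∀ j → A₃ zero (suc j) ≡ + 0
  A₃-row₀ j with toℕ j ≡ᵇ N
  ... | true  = cancel t
    where
    cancel : ∀ t → - (-1ℤ + + 2 * t) + - (+ 1 + + 2 * t) * -1ℤ + + 2 * -1ℤ ≡ + 0
    cancel = solve-∀
  ... | false = refl

  M₂ : Matrix (suc N)
  M₂ r c = A₃ (suc r) (suc c)

  -- M₂ r c = A (r+2) (c+2) + μ (c+1) p + ν c (A (r+2) 1 + p), where p = A (r+2) 0 − A (r+2) 1 is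
  -- (1 + 2t) − (−1 + 2t) in the border row and −1 − (−1) elsewhere.
  M₂≗bordered : ∀ r c → M₂ r c ≡ B r c
  M₂≗bordered r c with toℕ r ≡ᵇ N | toℕ c ≡ᵇ N
  ... | true  | true  = corner t
    where
    corner : ∀ t → + 0 + - (+ 1 + + 2 * t) * (+ 1 + + 2 * t + -1ℤ * (-1ℤ + + 2 * t))
                   + + 2 * (-1ℤ + + 2 * t + + 1 * (+ 1 + + 2 * t + -1ℤ * (-1ℤ + + 2 * t))) ≡ + 0
    corner = solve-∀
  ... | true  | false = trans (border-row (sgn (suc (suc (toℕ c)))) t)
                              (cong (λ s → s + + 2 * (t + + 1)) (sgn-suc-suc (toℕ c)))
    where
    border-row : ∀ s t → s + + 2 * t + + 1 * (+ 1 + + 2 * t + -1ℤ * (-1ℤ + + 2 * t))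
                         + + 0 * (-1ℤ + + 2 * t + + 1 * (+ 1 + + 2 * t + -1ℤ * (-1ℤ + + 2 * t)))
                         ≡ s + + 2 * (t + + 1)
    border-row = solve-∀
  ... | false | true  = trans (border-column (sgn (suc (suc (toℕ r)))) t)
                              (cong (λ s → - (s + + 2 * (t + + 1))) (sgn-suc-suc (toℕ r)))
    where
    border-column : ∀ s t → - (s + + 2 * t) + - (+ 1 + + 2 * t) * + 0 + + 2 * -1ℤ ≡ - (s + + 2 * (t + + 1))
    border-column = solve-∀
  ... | false | false = interior (transitiveEntry (toℕ r) (toℕ c))
    where
    interior : ∀ x → x + + 0 + + 0 * -1ℤ ≡ x
    interior = solve-∀

det-bordered-1 : ∀ t → det 2 (bordered 1 t) ≡ (+ 1 + + 2 * t) * (+ 1 + + 2 * t)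
det-bordered-1 t = expand t
  where
  expand : ∀ t → + 0 + (-1ℤ * - (+ 1 + + 2 * t) * (+ 1 * (+ 1 + + 2 * t) * + 1 + + 0) + + 0)
                 ≡ (+ 1 + + 2 * t) * (+ 1 + + 2 * t)
  expand = solve-∀

det-bordered-odd : ∀ j t → det (suc (suc (j ℕ.+ j))) (bordered (suc (j ℕ.+ j)) t)
                           ≡ (+ suc (j ℕ.+ j) + + 2 * t) * (+ suc (j ℕ.+ j) + + 2 * t)
det-bordered-odd zero    t = det-bordered-1 t
det-bordered-odd (suc j) t rewrite ℕ.+-suc j j = begin
  det _ (bordered (suc (suc N)) t)                 ≡⟨ det-bordered-step N t ⟩
  det _ (bordered N (t + + 1))                     ≡⟨ det-bordered-odd j (t + + 1) ⟩
  (+ N + + 2 * (t + + 1)) * (+ N + + 2 * (t + + 1)) ≡⟨ cong (λ y → y * y) (shift (+ N) t) ⟩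
  (+ 2 + + N + + 2 * t) * (+ 2 + + N + + 2 * t)    ∎
  where
  open ≡-Reasoning
  N : ℕ
  N = suc (j ℕ.+ j)
  shift : ∀ x t → x + + 2 * (t + + 1) ≡ + 2 + x + + 2 * t
  shift = solve-∀

skew-L≡bordered : ∀ N i j → skew (suc N) (L-arc (suc N)) i j ≡ bordered N (+ 0) i j
skew-L≡bordered N i j with toℕ i ≡ᵇ N | toℕ j ≡ᵇ N
... | true  | true  = refl
... | true  | false with isEven (toℕ j)
...   | true  = refl
...   | false = refl
skew-L≡bordered N i j | false | true with isEven (toℕ i)
...   | true  = refl
...   | false = refl
skew-L≡bordered N i j | false | false with toℕ i <ᵇ toℕ j in i<j | toℕ j <ᵇ toℕ i in j<i
...   | true  | true  =
  ⊥-elim (ℕ.<-asym (ℕ.<ᵇ⇒< (toℕ i) (toℕ j) (subst T (sym i<j) _))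
                   (ℕ.<ᵇ⇒< (toℕ j) (toℕ i) (subst T (sym j<i) _)))
...   | true  | false = refl
...   | false | true  = refl
...   | false | false = refl

detL-even : ∀ k → detL (suc (suc (k ℕ.+ k))) ≡ + suc (k ℕ.+ k) * + suc (k ℕ.+ k)
detL-even k = begin
  detL (suc (suc (k ℕ.+ k)))              ≡⟨ det-cong _ (skew-L≡bordered (suc (k ℕ.+ k))) ⟩
  det _ (bordered (suc (k ℕ.+ k)) (+ 0))  ≡⟨ det-bordered-odd k (+ 0) ⟩
  (x + + 2 * + 0) * (x + + 2 * + 0)       ≡⟨ cong (λ y → y * y) (+-identityʳ x) ⟩
  x * x                                   ∎
  where
  open ≡-Reasoning
  x : ℤ
  x = + suc (k ℕ.+ k)

detL-recurrence : ∀ k → detL (suc (suc (suc (suc (k ℕ.+ k)))))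
                        ≡ detL (suc (suc (k ℕ.+ k))) + + 4 * + suc (suc (k ℕ.+ k))
detL-recurrence k = begin
  detL (suc (suc (suc (suc (k ℕ.+ k)))))
    ≡⟨ subst (λ m → detL (suc (suc m)) ≡ + suc m * + suc m) (ℕ.+-suc (suc k) k) (detL-even (suc k)) ⟩
  (+ 2 + x) * (+ 2 + x)
    ≡⟨ expand x ⟩
  x * x + + 4 * (+ 1 + x)
    ≡⟨ cong (λ d → d + + 4 * (+ 1 + x)) (sym (detL-even k)) ⟩
  detL (suc (suc (k ℕ.+ k))) + + 4 * + suc (suc (k ℕ.+ k)) ∎
  where
  open ≡-Reasoning
  x : ℤ
  x = + suc (k ℕ.+ k)
  expand : ∀ x → (+ 2 + x) * (+ 2 + x) ≡ x * x + + 4 * (+ 1 + x)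
  expand = solve-∀

theorem4p3 : (n : ℕ) → 0 < n → (∃ λ k → n ≡ k ℕ.+ k) →
    (4 ≤ n → detL n ≡ detL (n ∸ 2) ℤ.+ (+ 4) ℤ.* (+ (n ∸ 2)))
    × (detL n ≡ (+ (n ∸ 1)) ℤ.* (+ (n ∸ 1)))
theorem4p3 .(zero ℕ.+ zero) () (zero , refl)
theorem4p3 .(suc k ℕ.+ suc k) _ (suc k , refl) rewrite ℕ.+-suc k k = recurrence k , detL-even k
  where
  recurrence : ∀ k → 4 ≤ suc (suc (k ℕ.+ k)) →
    detL (suc (suc (k ℕ.+ k))) ≡ detL (k ℕ.+ k) + + 4 * + (k ℕ.+ k)
  recurrence zero    (ℕ.s≤s (ℕ.s≤s ()))
  recurrence (suc k) _ rewrite ℕ.+-suc k k = detL-recurrence k
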